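{- Let $\mathbb{K}$ be a field, $\rho:\mathbb{N}^+\to\mathbb{K}$ any function, and $f(x)\in\mathbb{K}[[x]]$ with $$1+\sum_{n\ge 1}\Big(\sum_{F\in PF(n)}\prod_{h\in\mathcal{H}(F)}\rho(h)\Big)x^n=f(x).$$ Then for every $n\ge1$ with $[x^{n-1}]f(x)\neq0$, $$\rho(n)=-\frac{[x^n]f(x)^{ -1}}{[x^{n-1}]f(x)}.$$
   Context: A plane tree is a rooted unlabeled tree in which the (nonempty) subtrees of each vertex are arranged in linear order. A plane forest is a linearly ordered sequence of (nonempty) plane trees; $PF(n)$ is the set of plane forests with $n$ vertices in total. For a vertex $u$ of a forest $F$, the hook length $h_u$ is the number of descendants of $u$ in its tree (counting $u$ itself), and $\mathcal{H}(F)$ is the multiset of hook lengths of all vertices of $F$; the product is over all vertices. $[x^n]g(x)$ is the coefficient of $x^n$ in $g(x)$. -}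

module Defs where

open import Level using (Level; _⊔_)
open import Algebra.Bundles using (CommutativeRing)
open import Data.Nat as ℕ using (ℕ; zero; suc; _∸_)
open import Data.List as List using (List; []; _∷_; concatMap; upTo; map)
open import Relation.Nullary using (¬_)

record Field (c ℓ : Level) : Set (Level.suc (c ⊔ ℓ)) where
  field
    commutativeRing : CommutativeRing c ℓ
  open CommutativeRing commutativeRing public
  field
    0≉1     : ¬ (0# ≈ 1#)
    inverse : (x : Carrier) → ¬ (x ≈ 0#) → Carrier
    inverseʳ : (x : Carrier) (x≉0 : ¬ (x ≈ 0#)) → (x * inverse x x≉0) ≈ 1#

-- Plane trees and plane forests.
-- A plane tree is a root together with the (linearly ordered) list of its
-- subtrees; a plane forest is a list of plane trees.

data Tree : Set where
  node : List Tree → Tree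

Forest : Set
Forest = List Tree

mutual
  treeSize : Tree → ℕ
  treeSize (node ts) = suc (forestSize ts)

  forestSize : Forest → ℕ
  forestSize []       = 0
  forestSize (t ∷ ts) = treeSize t ℕ.+ forestSize ts

-- Enumeration of all plane forests with n vertices (with fuel ≥ n).
-- A nonempty forest with n+1 vertices is a first tree with k+1 vertices
-- (k = 0..n), i.e. a root above a forest with k vertices, followed by a
-- forest with n - k vertices.
forestsF : ℕ → ℕ → List Forest
forestsF _          zero    = [] ∷ []
forestsF zero       (suc n) = []
forestsF (suc fuel) (suc n) =
  concatMap (λ k →
    concatMap (λ sub →
      map (λ rest → node sub ∷ rest) (forestsF fuel (n ∸ k)))
      (forestsF fuel k))
    (upTo (suc n))

PF : ℕ → List Forest
PF n = forestsF n n

module _ {c ℓ} (K : Field c ℓ) where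
  open Field K

  sumL : List Carrier → Carrier
  sumL = List.foldr _+_ 0#

  -- ∏_{u ∈ F} ρ(h_u): the hook length of the root of node ts is
  -- 1 + forestSize ts = treeSize (node ts).
  mutual
    hookProdT : (ℕ → Carrier) → Tree → Carrier
    hookProdT ρ (node ts) = ρ (suc (forestSize ts)) * hookProdF ρ ts

    hookProdF : (ℕ → Carrier) → Forest → Carrier
    hookProdF ρ []       = 1#
    hookProdF ρ (t ∷ ts) = hookProdT ρ t * hookProdF ρ ts

  forestSum : (ℕ → Carrier) → ℕ → Carrier
  forestSum ρ n = sumL (map (hookProdF ρ) (PF n))

  -- Formal power series over K are represented by coefficient sequences
  -- ℕ → Carrier; coefficient n of the product f·g:
  mulCoeff : (ℕ → Carrier) → (ℕ → Carrier) → ℕ → Carrier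
  mulCoeff f g n = sumL (map (λ k → f k * g (n ∸ k)) (upTo (suc n)))

  oneCoeff : ℕ → Carrier
  oneCoeff zero    = 1#
  oneCoeff (suc _) = 0#

  IsInverseSeries : (ℕ → Carrier) → (ℕ → Carrier) → Set ℓ
  IsInverseSeries f g = ∀ n → mulCoeff f g n ≈ oneCoeff n

-- A nonempty plane forest is a first tree, i.e. a root above a forest with
-- k vertices, followed by a forest with n - k vertices.  Since the root of
-- that tree has hook length k + 1, the forest series satisfies
-- f = 1 + x·t·f with t(x) = Σₖ ρ(k+1) fₖ xᵏ, so f⁻¹ = 1 - x·t, i.e.
-- [xⁿ⁺¹] f⁻¹ = -ρ(n+1)·[xⁿ] f.
module Submission where

open import Defs
open import Level using (Level)
open import Data.Nat using (ℕ; suc)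
open import Relation.Nullary using (¬_)

open import Data.Nat as ℕ using (zero; _∸_; _≤_; _<_; z≤n; s≤s)
open import Data.Nat.Properties
  using (≤-refl; ≤-trans; ≤-pred; m∸n≤m; n∸n≡0; m∸[m∸n]≡n; +-∸-assoc; m+[n∸m]≡n)
open import Data.Nat.Induction using (<-rec)
open import Data.List using (List; []; _∷_; map; applyUpTo; upTo; concatMap; _++_)
open import Data.List.Properties using (map-∘)
open import Data.List.Relation.Unary.All as All using (All; []; _∷_)
open import Data.List.Relation.Unary.All.Properties using (applyUpTo⁺₁; concat⁺; map⁺)
open import Data.Maybe using (nothing)
open import Function using (id; _∘_)
open import Relation.Binary.PropositionalEquality as ≡ using (_≡_)
open import Tactic.RingSolver.Core.AlmostCommutativeRing using (fromCommutativeRing)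

module Series {c ℓ} (K : Field c ℓ) where
  open Field K
  open import Relation.Binary.Reasoning.Setoid setoid
  open import Algebra.Properties.Group +-group using (ε⁻¹≈ε; inverseʳ-unique; ⁻¹-involutive)
  open import Algebra.Properties.Ring ring using (-‿distribˡ-*)
  open import Algebra.Properties.AbelianGroup +-abelianGroup using (⁻¹-∙-comm)
  open import Tactic.RingSolver.NonReflective (fromCommutativeRing commutativeRing (λ _ → nothing))

  ≡⇒≈ : ∀ {x y} → x ≡ y → x ≈ y
  ≡⇒≈ ≡.refl = refl

  ∑ : ℕ → (ℕ → Carrier) → Carrier
  ∑ zero    a = 0#
  ∑ (suc n) a = a 0 + ∑ n (a ∘ suc)

  sumL-map-applyUpTo : ∀ (a : ℕ → Carrier) h n → sumL K (map a (applyUpTo h n)) ≡ ∑ n (a ∘ h)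
  sumL-map-applyUpTo a h zero    = ≡.refl
  sumL-map-applyUpTo a h (suc n) = ≡.cong (a (h 0) +_) (sumL-map-applyUpTo a (h ∘ suc) n)

  mulCoeff≡∑ : ∀ a b n → mulCoeff K a b n ≡ ∑ (suc n) (λ k → a k * b (n ∸ k))
  mulCoeff≡∑ a b n = sumL-map-applyUpTo _ id (suc n)

  ∑-cong : ∀ n {a b : ℕ → Carrier} → (∀ {k} → k < n → a k ≈ b k) → ∑ n a ≈ ∑ n b
  ∑-cong zero    a≈b = refl
  ∑-cong (suc n) a≈b = +-cong (a≈b (s≤s z≤n)) (∑-cong n (a≈b ∘ s≤s))

  ∑-last : ∀ n a → ∑ (suc n) a ≈ ∑ n a + a n
  ∑-last zero    a = +-comm (a 0) 0#
  ∑-last (suc n) a = begin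
    a 0 + ∑ (suc n) (a ∘ suc)       ≈⟨ +-congˡ (∑-last n (a ∘ suc)) ⟩
    a 0 + (∑ n (a ∘ suc) + a (suc n)) ≈⟨ +-assoc _ _ _ ⟨
    ∑ (suc n) a + a (suc n)         ∎

  -‿∑ : ∀ n a → ∑ n (λ k → - a k) ≈ - ∑ n a
  -‿∑ zero    a = sym ε⁻¹≈ε
  -‿∑ (suc n) a = trans (+-congˡ (-‿∑ n (a ∘ suc))) (⁻¹-∙-comm (a 0) (∑ n (a ∘ suc)))

  ∑-reverse : ∀ n a → ∑ (suc n) a ≈ ∑ (suc n) (λ k → a (n ∸ k))
  ∑-reverse zero    a = refl
  ∑-reverse (suc n) a = begin
    a 0 + ∑ (suc n) (a ∘ suc)                          ≈⟨ +-congˡ (∑-reverse n (a ∘ suc)) ⟩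
    a 0 + ∑ (suc n) (λ k → a (suc (n ∸ k)))            ≈⟨ +-comm _ _ ⟩
    ∑ (suc n) (λ k → a (suc (n ∸ k))) + a 0
      ≈⟨ +-cong (∑-cong (suc n) shift) (≡⇒≈ (≡.cong a (≡.sym (n∸n≡0 n)))) ⟩
    ∑ (suc n) (λ k → a (suc n ∸ k)) + a (suc n ∸ suc n) ≈⟨ ∑-last (suc n) (λ k → a (suc n ∸ k)) ⟨
    ∑ (suc (suc n)) (λ k → a (suc n ∸ k))              ∎
    where
    shift : ∀ {k} → k < suc n → a (suc (n ∸ k)) ≈ a (suc n ∸ k)
    shift k<1+n = ≡⇒≈ (≡.cong a (≡.sym (+-∸-assoc 1 (≤-pred k<1+n))))

  sumL-++ : ∀ {A : Set} (h : A → Carrier) xs ys →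
            sumL K (map h (xs ++ ys)) ≈ sumL K (map h xs) + sumL K (map h ys)
  sumL-++ h []       ys = sym (+-identityˡ _)
  sumL-++ h (x ∷ xs) ys = trans (+-congˡ (sumL-++ h xs ys)) (sym (+-assoc _ _ _))

  sumL-concatMap : ∀ {A B : Set} (h : B → Carrier) (F : A → List B) xs →
                   sumL K (map h (concatMap F xs)) ≈ sumL K (map (λ x → sumL K (map h (F x))) xs)
  sumL-concatMap h F []       = refl
  sumL-concatMap h F (x ∷ xs) = trans (sumL-++ h (F x) (concatMap F xs)) (+-congˡ (sumL-concatMap h F xs))

  sumL-cong : ∀ {A : Set} {h h′ : A → Carrier} xs → All (λ x → h x ≈ h′ x) xs →
              sumL K (map h xs) ≈ sumL K (map h′ xs)
  sumL-cong []       []             = refl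
  sumL-cong (x ∷ xs) (hx≈h′x ∷ all) = +-cong hx≈h′x (sumL-cong xs all)

  sumL-*ˡ : ∀ {A : Set} a (h : A → Carrier) xs → sumL K (map (λ x → a * h x) xs) ≈ a * sumL K (map h xs)
  sumL-*ˡ a h []       = sym (zeroʳ a)
  sumL-*ˡ a h (x ∷ xs) = trans (+-congˡ (sumL-*ˡ a h xs)) (sym (distribˡ a _ _))

  sumL-*ʳ : ∀ {A : Set} a (h : A → Carrier) xs → sumL K (map (λ x → h x * a) xs) ≈ sumL K (map h xs) * a
  sumL-*ʳ a h []       = sym (zeroˡ a)
  sumL-*ʳ a h (x ∷ xs) = trans (+-congˡ (sumL-*ʳ a h xs)) (sym (distribʳ a _ _))

  mulCoeff-suc : ∀ a b n → mulCoeff K a b (suc n) ≡ a 0 * b (suc n) + mulCoeff K (a ∘ suc) b n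
  mulCoeff-suc a b n =
    ≡.trans (mulCoeff≡∑ a b (suc n)) (≡.cong (a 0 * b (suc n) +_) (≡.sym (mulCoeff≡∑ (a ∘ suc) b n)))

  mulCoeff-cong : ∀ n {a a′ b b′ : ℕ → Carrier} →
                  (∀ {k} → k ≤ n → a k ≈ a′ k) → (∀ {k} → k ≤ n → b k ≈ b′ k) →
                  mulCoeff K a b n ≈ mulCoeff K a′ b′ n
  mulCoeff-cong n {a} {a′} {b} {b′} a≈a′ b≈b′ = begin
    mulCoeff K a b n                      ≡⟨ mulCoeff≡∑ a b n ⟩
    ∑ (suc n) (λ k → a k * b (n ∸ k))
      ≈⟨ ∑-cong (suc n) (λ {k} k<1+n → *-cong (a≈a′ (≤-pred k<1+n)) (b≈b′ (m∸n≤m n k))) ⟩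
    ∑ (suc n) (λ k → a′ k * b′ (n ∸ k))   ≡⟨ mulCoeff≡∑ a′ b′ n ⟨
    mulCoeff K a′ b′ n                    ∎

  mulCoeff-comm : ∀ a b n → mulCoeff K a b n ≈ mulCoeff K b a n
  mulCoeff-comm a b n = begin
    mulCoeff K a b n                                ≡⟨ mulCoeff≡∑ a b n ⟩
    ∑ (suc n) (λ k → a k * b (n ∸ k))               ≈⟨ ∑-reverse n (λ k → a k * b (n ∸ k)) ⟩
    ∑ (suc n) (λ k → a (n ∸ k) * b (n ∸ (n ∸ k)))   ≈⟨ ∑-cong (suc n) swap ⟩
    ∑ (suc n) (λ k → b k * a (n ∸ k))               ≡⟨ mulCoeff≡∑ b a n ⟨
    mulCoeff K b a n                                ∎
    where
    swap : ∀ {k} → k < suc n → a (n ∸ k) * b (n ∸ (n ∸ k)) ≈ b k * a (n ∸ k)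
    swap k<1+n = trans (*-comm _ _) (*-congʳ (≡⇒≈ (≡.cong b (m∸[m∸n]≡n (≤-pred k<1+n)))))

  mulCoeff-last : ∀ a b n → b 0 ≈ 1# → mulCoeff K a b n ≈ ∑ n (λ k → a k * b (n ∸ k)) + a n
  mulCoeff-last a b n b0≈1 = begin
    mulCoeff K a b n                            ≡⟨ mulCoeff≡∑ a b n ⟩
    ∑ (suc n) (λ k → a k * b (n ∸ k))           ≈⟨ ∑-last n (λ k → a k * b (n ∸ k)) ⟩
    ∑ n (λ k → a k * b (n ∸ k)) + a n * b (n ∸ n)
      ≈⟨ +-congˡ (*-congˡ (trans (≡⇒≈ (≡.cong b (n∸n≡0 n))) b0≈1)) ⟩
    ∑ n (λ k → a k * b (n ∸ k)) + a n * 1#      ≈⟨ +-congˡ (*-identityʳ (a n)) ⟩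
    ∑ n (λ k → a k * b (n ∸ k)) + a n           ∎

  inverseSeries-suc : ∀ {f g} t → f 0 ≈ 1# → (∀ m → f (suc m) ≈ mulCoeff K t f m) →
                      IsInverseSeries K f g → ∀ m → g (suc m) ≈ - t m
  inverseSeries-suc {f} {g} t f0≈1 f-rec fg≈1 = <-rec _ step
    where
    g0≈1 : g 0 ≈ 1#
    g0≈1 = begin
      g 0              ≈⟨ *-identityˡ (g 0) ⟨
      1# * g 0         ≈⟨ *-congʳ f0≈1 ⟨
      f 0 * g 0        ≈⟨ +-identityʳ _ ⟨
      f 0 * g 0 + 0#   ≈⟨ fg≈1 0 ⟩
      1#               ∎

    step : ∀ m → (∀ {j} → j < m → g (suc j) ≈ - t j) → g (suc m) ≈ - t m
    step m ih = inverseʳ-unique (t m) (g (suc m)) (begin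
      t m + g (suc m)                               ≈⟨ +-identityˡ _ ⟨
      0# + (t m + g (suc m))                        ≈⟨ +-congʳ (-‿inverseʳ S) ⟨
      (S + - S) + (t m + g (suc m))
        -- - S enters as a separate variable: this solver instance cannot cancel S - S
        ≈⟨ solve 4 (λ s s′ x y → ((s ⊕ s′) ⊕ (x ⊕ y)) ⊜ ((s ⊕ x) ⊕ (s′ ⊕ y))) refl S (- S) (t m) (g (suc m)) ⟩
      (S + t m) + (- S + g (suc m))                 ≈⟨ +-cong (sym f-suc) (sym g-tail) ⟩
      f (suc m) + mulCoeff K (g ∘ suc) f m          ≈⟨ +-congʳ (trans (*-congʳ g0≈1) (*-identityˡ _)) ⟨
      g 0 * f (suc m) + mulCoeff K (g ∘ suc) f m    ≡⟨ mulCoeff-suc g f m ⟨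
      mulCoeff K g f (suc m)                        ≈⟨ mulCoeff-comm g f (suc m) ⟩
      mulCoeff K f g (suc m)                        ≈⟨ fg≈1 (suc m) ⟩
      0#                                            ∎)
      where
      S = ∑ m (λ k → t k * f (m ∸ k))

      f-suc : f (suc m) ≈ S + t m
      f-suc = trans (f-rec m) (mulCoeff-last t f m f0≈1)

      g-tail : mulCoeff K (g ∘ suc) f m ≈ - S + g (suc m)
      g-tail = begin
        mulCoeff K (g ∘ suc) f m                              ≈⟨ mulCoeff-last (g ∘ suc) f m f0≈1 ⟩
        ∑ m (λ k → g (suc k) * f (m ∸ k)) + g (suc m)         ≈⟨ +-congʳ (∑-cong m (λ j<m → *-congʳ (ih j<m))) ⟩
        ∑ m (λ k → - t k * f (m ∸ k)) + g (suc m)             ≈⟨ +-congʳ (∑-cong m (λ _ → sym (-‿distribˡ-* _ _))) ⟩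
        ∑ m (λ k → - (t k * f (m ∸ k))) + g (suc m)           ≈⟨ +-congʳ (-‿∑ m _) ⟩
        - S + g (suc m)                                       ∎

  y≈-x*a⇒x≈-y*b : ∀ {x y a b} → a * b ≈ 1# → y ≈ - (x * a) → x ≈ - (y * b)
  y≈-x*a⇒x≈-y*b {x} {y} {a} {b} ab≈1 y≈-xa = begin
    x                 ≈⟨ *-identityʳ x ⟨
    x * 1#            ≈⟨ *-congˡ ab≈1 ⟨
    x * (a * b)       ≈⟨ *-assoc x a b ⟨
    (x * a) * b       ≈⟨ ⁻¹-involutive _ ⟨
    - (- (x * a * b)) ≈⟨ -‿cong (-‿distribˡ-* (x * a) b) ⟩
    - (- (x * a) * b) ≈⟨ -‿cong (*-congʳ y≈-xa) ⟨
    - (y * b)         ∎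

  module Forests (ρ : ℕ → Carrier) where

    forestSumF : ℕ → ℕ → Carrier
    forestSumF fuel n = sumL K (map (hookProdF K ρ) (forestsF fuel n))

    -- the forests with n + 1 vertices whose first tree has k + 1 vertices
    forestsWithFirstTree : ℕ → ℕ → ℕ → List Forest
    forestsWithFirstTree fuel n k =
      concatMap (λ sub → map (λ rest → node sub ∷ rest) (forestsF fuel (n ∸ k))) (forestsF fuel k)

    forestsF-size : ∀ fuel n → All (λ F → forestSize F ≡ n) (forestsF fuel n)
    forestsF-size _          zero    = ≡.refl ∷ []
    forestsF-size zero       (suc n) = []
    forestsF-size (suc fuel) (suc n) = concat⁺ (map⁺ (applyUpTo⁺₁ id (suc n) withFirstTree-size))
      where
      withFirstTree-size : ∀ {k} → k < suc n → All (λ F → forestSize F ≡ suc n) (forestsWithFirstTree fuel n k)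
      withFirstTree-size {k} k<1+n = concat⁺ (map⁺ (All.map (λ |sub|≡k → map⁺ (All.map (λ |rest|≡n∸k →
        ≡.cong suc (≡.trans (≡.cong₂ ℕ._+_ |sub|≡k |rest|≡n∸k) (m+[n∸m]≡n (≤-pred k<1+n))))
        (forestsF-size fuel (n ∸ k)))) (forestsF-size fuel k)))

    sumL-hookProdF-∷ : ∀ t Fs → sumL K (map (hookProdF K ρ) (map (t ∷_) Fs)) ≈
                               hookProdT K ρ t * sumL K (map (hookProdF K ρ) Fs)
    sumL-hookProdF-∷ t Fs =
      trans (≡⇒≈ (≡.cong (sumL K) (≡.sym (map-∘ Fs)))) (sumL-*ˡ (hookProdT K ρ t) (hookProdF K ρ) Fs)

    forestSumF-suc : ∀ fuel n → forestSumF (suc fuel) (suc n) ≈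
                     mulCoeff K (λ k → ρ (suc k) * forestSumF fuel k) (forestSumF fuel) n
    forestSumF-suc fuel n =
      trans (sumL-concatMap hp (forestsWithFirstTree fuel n) (upTo (suc n)))
            (sumL-cong (upTo (suc n)) (All.universal split _))
      where
      hp = hookProdF K ρ

      split : ∀ k → sumL K (map hp (forestsWithFirstTree fuel n k)) ≈
                    (ρ (suc k) * forestSumF fuel k) * forestSumF fuel (n ∸ k)
      split k = begin
        sumL K (map hp (forestsWithFirstTree fuel n k))
          ≈⟨ sumL-concatMap hp _ Subs ⟩
        sumL K (map (λ sub → sumL K (map hp (map (node sub ∷_) Rests))) Subs)
          ≈⟨ sumL-cong Subs (All.universal (λ sub → sumL-hookProdF-∷ (node sub) Rests) _) ⟩
        sumL K (map (λ sub → hookProdT K ρ (node sub) * X) Subs)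
          ≈⟨ sumL-cong Subs (All.map (λ |sub|≡k → *-congʳ (*-congʳ (≡⇒≈ (≡.cong (ρ ∘ suc) |sub|≡k))))
                                     (forestsF-size fuel k)) ⟩
        sumL K (map (λ sub → (ρ (suc k) * hp sub) * X) Subs)
          ≈⟨ sumL-*ʳ X _ Subs ⟩
        sumL K (map (λ sub → ρ (suc k) * hp sub) Subs) * X
          ≈⟨ *-congʳ (sumL-*ˡ (ρ (suc k)) hp Subs) ⟩
        (ρ (suc k) * forestSumF fuel k) * X
          ∎
        where
        Subs  = forestsF fuel k
        Rests = forestsF fuel (n ∸ k)
        X     = forestSumF fuel (n ∸ k)

    forestSumF-fuel : ∀ {a b} n → n ≤ a → n ≤ b → forestSumF a n ≈ forestSumF b n
    forestSumF-fuel zero    _ _ = refl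
    forestSumF-fuel {suc a} {suc b} (suc n) (s≤s n≤a) (s≤s n≤b) = begin
      forestSumF (suc a) (suc n)                                        ≈⟨ forestSumF-suc a n ⟩
      mulCoeff K (λ k → ρ (suc k) * forestSumF a k) (forestSumF a) n    ≈⟨ mulCoeff-cong n (*-congˡ ∘ refuel) refuel ⟩
      mulCoeff K (λ k → ρ (suc k) * forestSumF b k) (forestSumF b) n    ≈⟨ forestSumF-suc b n ⟨
      forestSumF (suc b) (suc n)                                        ∎
      where
      refuel : ∀ {k} → k ≤ n → forestSumF a k ≈ forestSumF b k
      refuel {k} k≤n = forestSumF-fuel {a} {b} k (≤-trans k≤n n≤a) (≤-trans k≤n n≤b)

    forestSum-suc : ∀ n → forestSum K ρ (suc n) ≈ mulCoeff K (λ k → ρ (suc k) * forestSum K ρ k) (forestSum K ρ) n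
    forestSum-suc n = trans (forestSumF-suc n n) (mulCoeff-cong n (*-congˡ ∘ toOwnFuel) toOwnFuel)
      where
      toOwnFuel : ∀ {k} → k ≤ n → forestSumF n k ≈ forestSumF k k
      toOwnFuel {k} k≤n = forestSumF-fuel k k≤n ≤-refl

theorem3p4 : ∀ {c ℓ} (K : Field c ℓ) → let open Field K in
    (ρ : ℕ → Carrier) (f : ℕ → Carrier) →
    f 0 ≈ 1# →
    (∀ n → f (suc n) ≈ forestSum K ρ (suc n)) →
    (g : ℕ → Carrier) → IsInverseSeries K f g →
    (n : ℕ) → (f≉0 : ¬ (f n ≈ 0#)) →
    ρ (suc n) ≈ - (g (suc n) * inverse (f n) f≉0)
theorem3p4 K ρ f f0≈1 f₊≈forestSum g fg≈1 n fₙ≉0 =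
  y≈-x*a⇒x≈-y*b (inverseʳ (f n) fₙ≉0) (inverseSeries-suc t f0≈1 f-rec fg≈1 n)
  where
  open Field K
  open Series K
  open Forests ρ

  t : ℕ → Carrier
  t k = ρ (suc k) * f k

  f≈forestSum : ∀ k → f k ≈ forestSum K ρ k
  f≈forestSum zero    = trans f0≈1 (sym (+-identityʳ 1#))
  f≈forestSum (suc k) = f₊≈forestSum k

  f-rec : ∀ m → f (suc m) ≈ mulCoeff K t f m
  f-rec m = trans (f₊≈forestSum m) (trans (forestSum-suc m)
              (mulCoeff-cong m (λ {k} _ → *-congˡ (sym (f≈forestSum k))) (λ {k} _ → sym (f≈forestSum k))))
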